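{- Let $1<p<q$ be relatively prime integers. For every integer $h\ge0$, $L^s(h,p,q)=\lceil\frac{h+1}{2}\rceil p+q-((h+1)\bmod 2)$.
   Context: $H^s(n,p,q)=\lfloor (n-q)/p\rfloor+\lfloor (n-q+1)/p\rfloor$ for integers $n\ge q$, and $L^s(h,p,q)=\min\{n\ge q: H^s(n,p,q)>h\}$. -}

module Defs where

open import Data.Nat using (ℕ; suc; _+_; _∸_; _≤_; _<_; NonZero)
open import Data.Nat.DivMod using (_/_)
open import Data.Product using (_×_)

-- H^s(n,p,q) = ⌊(n-q)/p⌋ + ⌊(n-q+1)/p⌋, meaningful for n ≥ q
-- (truncated subtraction; only used with q ≤ n).
Hs : (n p q : ℕ) → .{{NonZero p}} → ℕ
Hs n p q = ((n ∸ q) / p) + ((suc (n ∸ q)) / p)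

IsLs : (h p q : ℕ) → .{{NonZero p}} → ℕ → Set
IsLs h p q n =
  (q ≤ n × h < Hs n p q) ×
  (∀ m → q ≤ m → h < Hs m p q → n ≤ m)

module Submission where

-- Write x = n − q.  Then H^s(n,p,q) = H(x) := ⌊x/p⌋ + ⌊(x+1)/p⌋,
-- so L^s(h,p,q) = q + x₀, where x₀ is the first point at which H exceeds h
-- (lemma isLs-shift).  H is easy to evaluate near multiples of p:
--   * for h = 2j the first point above h is x₀ = (j+1)p − 1, because there
--     ⌊(x₀+1)/p⌋ jumps to j+1 while ⌊x₀/p⌋ is still ≥ j, and below x₀ both
--     floors are ≤ j (firstAbove-even);
--   * for h = 2j+1 it is x₀ = (j+1)p, where both floors are ≥ j+1, while below
--     it ⌊y/p⌋ ≤ j and ⌊(y+1)/p⌋ ≤ j+1 (firstAbove-odd).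

open import Defs
open import Data.Nat using (ℕ; suc; _+_; _*_; _∸_; _<_; NonZero; _≤_; _≤?_; s≤s; s≤s⁻¹)
open import Data.Nat.DivMod
  using (_/_; _%_; m*n/n≡m; m*n%n≡0; [m+kn]%n≡m%n; /-monoˡ-≤; m<n*o⇒m/o<n)
open import Data.Nat.Coprimality using (Coprime)
open import Data.Nat.Properties
open import Data.Product using (_×_; _,_)
open import Relation.Nullary using (yes; no; contradiction)
open import Relation.Binary.PropositionalEquality using (_≡_; sym; trans; cong; cong₂; subst; module ≡-Reasoning)

H : (x p : ℕ) → .{{NonZero p}} → ℕ
H x p = x / p + suc x / p

FirstAbove : (h p : ℕ) → .{{NonZero p}} → ℕ → Set
FirstAbove h p x₀ = h < H x₀ p × (∀ y → y < x₀ → H y p ≤ h)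

isLs-shift : ∀ h p q x₀ .{{_ : NonZero p}} → FirstAbove h p x₀ → IsLs h p q (q + x₀)
isLs-shift h p q x₀ (above , below) =
  (m≤m+n q x₀ , subst (λ x → h < H x p) (sym (m+n∸m≡n q x₀)) above) , minimal
  where
  minimal : ∀ m → q ≤ m → h < Hs m p q → q + x₀ ≤ m
  minimal m q≤m h<H with q + x₀ ≤? m
  ... | yes q+x₀≤m = q+x₀≤m
  ... | no q+x₀≰m = contradiction (below (m ∸ q) m∸q<x₀) (<⇒≱ h<H)
    where
    m∸q<x₀ : m ∸ q < x₀
    m∸q<x₀ = +-cancelˡ-< q (m ∸ q) x₀
      (subst (_< q + x₀) (sym (m+[n∸m]≡n q≤m)) (≰⇒> q+x₀≰m))

floor-lower : ∀ j a p .{{_ : NonZero p}} → j * p ≤ a → j ≤ a / p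
floor-lower j a p jp≤a = subst (_≤ a / p) (m*n/n≡m j p) (/-monoˡ-≤ p jp≤a)

floor-upper : ∀ j a p .{{_ : NonZero p}} → a < suc j * p → a / p ≤ j
floor-upper j a p a<[1+j]p = s≤s⁻¹ (m<n*o⇒m/o<n a<[1+j]p)

double : ∀ j → j + j ≡ j * 2
double j = trans (cong (j +_) (sym (+-identityʳ j))) (*-comm 2 j)

-- For h = 2j the first point above h is (j+1)p − 1 (p written as suc p′ so
-- that (j+1)p − 1 = p′ + jp computes).
firstAbove-even : ∀ j p′ → FirstAbove (j * 2) (suc p′) (suc j * suc p′ ∸ 1)
firstAbove-even j p′ = above , below
  where
  p = suc p′
  x₀ = suc j * p ∸ 1

  above : j * 2 < H x₀ p
  above = begin-strict
    j * 2          ≡⟨ sym (double j) ⟩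
    j + j          <⟨ n<1+n (j + j) ⟩
    suc (j + j)    ≡⟨ sym (+-suc j j) ⟩
    j + suc j      ≤⟨ +-mono-≤ (floor-lower j x₀ p (m≤n+m (j * p) p′))
                               (floor-lower (suc j) (suc x₀) p ≤-refl) ⟩
    H x₀ p         ∎
    where open ≤-Reasoning

  below : ∀ y → y < x₀ → H y p ≤ j * 2
  below y y<x₀ = subst (H y p ≤_) (double j)
    (+-mono-≤ (floor-upper j y p (<-trans y<x₀ (n<1+n x₀)))
              (floor-upper j (suc y) p (s≤s y<x₀)))

firstAbove-odd : ∀ j p .{{_ : NonZero p}} → FirstAbove (suc (j * 2)) p (suc j * p)
firstAbove-odd j p = above , below
  where
  x₀ = suc j * p

  above : suc (j * 2) < H x₀ p
  above = begin-strict
    suc (j * 2)        ≡⟨ cong suc (sym (double j)) ⟩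
    suc (j + j)        <⟨ n<1+n (suc (j + j)) ⟩
    suc (suc (j + j))  ≡⟨ cong suc (sym (+-suc j j)) ⟩
    suc j + suc j      ≤⟨ +-mono-≤ (floor-lower (suc j) x₀ p ≤-refl)
                                   (floor-lower (suc j) (suc x₀) p (n≤1+n x₀)) ⟩
    H x₀ p             ∎
    where open ≤-Reasoning

  below : ∀ y → y < x₀ → H y p ≤ suc (j * 2)
  below y y<x₀ = begin
    y / p + suc y / p  ≤⟨ +-mono-≤ (floor-upper j y p y<x₀) (/-monoˡ-≤ p y<x₀) ⟩
    j + x₀ / p         ≡⟨ cong (j +_) (m*n/n≡m (suc j) p) ⟩
    j + suc j          ≡⟨ +-suc j j ⟩
    suc (j + j)        ≡⟨ cong suc (double j) ⟩
    suc (j * 2)        ∎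
    where open ≤-Reasoning

data Parity : ℕ → Set where
  even : ∀ j → Parity (j * 2)
  odd  : ∀ j → Parity (suc (j * 2))

parity : ∀ h → Parity h
parity 0 = even 0
parity (suc h) with parity h
... | even j = odd j
... | odd j  = even (suc j)

-- The paper's closed form ⌈(h+1)/2⌉p + q − ((h+1) mod 2), computed as
-- ⌊(h+2)/2⌋p + q ∸ ((h+1) % 2), equals q + x₀ for h = 2j …
closedForm-even : ∀ j p′ q →
  ((j * 2 + 2) / 2) * suc p′ + q ∸ ((j * 2 + 1) % 2) ≡ q + (suc j * suc p′ ∸ 1)
closedForm-even j p′ q = begin
  ((j * 2 + 2) / 2) * p + q ∸ ((j * 2 + 1) % 2)  ≡⟨ cong₂ (λ a b → a * p + q ∸ b) half parity-odd ⟩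
  suc j * p + q ∸ 1                               ≡⟨ +-comm (suc j * p ∸ 1) q ⟩
  q + (suc j * p ∸ 1)                             ∎
  where
  open ≡-Reasoning
  p = suc p′
  half : (j * 2 + 2) / 2 ≡ suc j
  half = trans (cong (_/ 2) (+-comm (j * 2) 2)) (m*n/n≡m (suc j) 2)
  parity-odd : (j * 2 + 1) % 2 ≡ 1
  parity-odd = trans (cong (_% 2) (+-comm (j * 2) 1)) ([m+kn]%n≡m%n 1 j 2)

closedForm-odd : ∀ j p q .{{_ : NonZero p}} →
  ((suc (j * 2) + 2) / 2) * p + q ∸ ((suc (j * 2) + 1) % 2) ≡ q + suc j * p
closedForm-odd j p q = begin
  ((suc (j * 2) + 2) / 2) * p + q ∸ ((suc (j * 2) + 1) % 2)  ≡⟨ cong₂ (λ a b → a * p + q ∸ b) half parity-even ⟩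
  suc j * p + q                                               ≡⟨ +-comm (suc j * p) q ⟩
  q + suc j * p                                               ∎
  where
  open ≡-Reasoning
  half : (suc (j * 2) + 2) / 2 ≡ suc j
  half = trans (cong (_/ 2) (+-comm (suc (j * 2)) 2))
    (≤-antisym (floor-upper (suc j) (suc (suc j * 2)) 2 ≤-refl)
               (floor-lower (suc j) (suc (suc j * 2)) 2 (n≤1+n (suc j * 2))))
  parity-even : (suc (j * 2) + 1) % 2 ≡ 0
  parity-even = trans (cong (_% 2) (+-comm (suc (j * 2)) 1)) (m*n%n≡0 (suc j) 2)

lemma9 : (p q : ℕ) → .{{_ : NonZero p}} → 1 < p → p < q → Coprime p q →
    (h : ℕ) → IsLs h p q (((h + 2) / 2) * p + q ∸ ((h + 1) % 2))
lemma9 p@(suc p′) q _ _ _ h with parity h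
... | even j = subst (IsLs (j * 2) p q) (sym (closedForm-even j p′ q))
                (isLs-shift (j * 2) p q _ (firstAbove-even j p′))
... | odd j  = subst (IsLs (suc (j * 2)) p q) (sym (closedForm-odd j p q))
                (isLs-shift (suc (j * 2)) p q _ (firstAbove-odd j p))
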